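{- Let $h_{n,r}$ be the number of run-sorted permutations of $[n]$ having exactly $r$ right-to-left minima. Then $h_{1,1}=1$ and for all integers $n,r$ with $2\le r\le n$, $$h_{n,r}=h_{n-1,r-1}+(r-1)\,h_{n-1,r}.$$
   Context: A permutation of $[n]$ is run-sorted if it is the concatenation of the blocks of a set partition of $[n]$ in block representation (elements of each block increasing, blocks ordered by increasing minima); equivalently, the minima of its successive runs (maximal increasing factors) are increasing. A right-to-left minimum of $\pi=\pi_1\cdots\pi_n$ is an entry $\pi_i$ with $\pi_i<\pi_j$ for all $j>i$. Here $h_{m,r}=0$ when $r>m$. -}

module Defs where

open import Data.Nat using (ℕ; zero; suc; _<_; _<?_; _≟_)
open import Data.Bool using (Bool; true; false; _∧_; not)
open import Data.List using (List; []; _∷_; length; filter; map; concatMap; upTo)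
open import Relation.Nullary.Decidable using (⌊_⌋)
open import Relation.Nullary using (Dec; yes; no)

range : ℕ → List ℕ
range n = map suc (upTo n)

words : List ℕ → ℕ → List (List ℕ)
words A zero = [] ∷ []
words A (suc k) = concatMap (λ a → map (a ∷_) (words A k)) A

memb : ℕ → List ℕ → Bool
memb x [] = false
memb x (y ∷ ys) = ⌊ x ≟ y ⌋ Data.Bool.∨ memb x ys

distinct : List ℕ → Bool
distinct [] = true
distinct (x ∷ xs) = not (memb x xs) ∧ distinct xs

-- permutations of [n] in one-line notation: words of length n over [n] without repetition
perms : ℕ → List (List ℕ)
perms n = filter (λ w → distinct w Data.Bool.≟ true) (words (range n) n)

runs : List ℕ → List (List ℕ)
runs [] = []
runs (x ∷ xs) = attach x (runs xs)
  where
  attach : ℕ → List (List ℕ) → List (List ℕ)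
  attach x [] = (x ∷ []) ∷ []
  attach x ([] ∷ rs) = (x ∷ []) ∷ rs
  attach x ((y ∷ r) ∷ rs) with x <? y
  ... | yes _ = (x ∷ y ∷ r) ∷ rs
  ... | no  _ = (x ∷ []) ∷ (y ∷ r) ∷ rs

-- first entries (= minima) of the runs
heads : List (List ℕ) → List ℕ
heads [] = []
heads ([] ∷ rs) = heads rs
heads ((x ∷ _) ∷ rs) = x ∷ heads rs

strictlyIncreasing : List ℕ → Bool
strictlyIncreasing [] = true
strictlyIncreasing (x ∷ []) = true
strictlyIncreasing (x ∷ y ∷ xs) = ⌊ x <? y ⌋ ∧ strictlyIncreasing (y ∷ xs)

runSorted : List ℕ → Bool
runSorted w = strictlyIncreasing (heads (runs w))

allGreater : ℕ → List ℕ → Bool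
allGreater x [] = true
allGreater x (y ∷ ys) = ⌊ x <? y ⌋ ∧ allGreater x ys

rlMinima : List ℕ → ℕ
rlMinima [] = zero
rlMinima (x ∷ xs) with allGreater x xs
... | true  = suc (rlMinima xs)
... | false = rlMinima xs

h : ℕ → ℕ → ℕ
h n r = length (filter (λ w → (runSorted w ∧ ⌊ rlMinima w ≟ r ⌋) Data.Bool.≟ true) (perms n))

-- A word is run-sorted exactly when each of its run minima (the first entry and every
-- entry smaller than its predecessor) is a right-to-left minimum.  Every permutation
-- of [n] arises exactly once by inserting n into a permutation of [n-1], and the result
-- is run-sorted exactly when the original one is and n goes either at the end, creating
-- one new right-to-left minimum, or immediately before one of the right-to-left minima
-- other than the first entry, which leaves their number unchanged.  So a run-sorted
-- permutation with r right-to-left minima has one child with r + 1 and r - 1 children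
-- with r of them, which is the recurrence.
module Submission where

open import Defs
open import Data.Bool using (Bool; true; false; _∧_; _∨_; if_then_else_)
import Data.Bool as Bool
open import Data.Bool.Properties using (∧-zeroʳ; ∨-zeroʳ; not-¬)
open import Data.Empty using (⊥-elim)
open import Data.List
  using (List; []; _∷_; _++_; [_]; map; length; filter; replicate; concatMap; cartesianProductWith)
open import Data.List.Properties
  using (∷-injective; ∷-injectiveˡ; ∷-injectiveʳ; map-++; map-replicate; map-id; length-++; length-replicate;
         filter-++; filter-all; filter-none; filter-accept; filter-reject)
open import Data.List.Membership.Propositional using (_∈_; _∉_; lose; find)
open import Data.List.Membership.Propositional.Properties
  using (∈-map⁺; ∈-map⁻; ∈-upTo⁺; ∈-upTo⁻; ∈-cartesianProductWith⁺; ∈-cartesianProductWith⁻;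
         ∈-filter⁺; ∈-filter⁻; ∈-concatMap⁺; ∈-concatMap⁻; ∈-∃++; ∈-++⁺ˡ; ∈-++⁺ʳ)
open import Data.List.Membership.Propositional.Properties.WithK using (unique∧set⇒bag)
open import Data.List.Relation.Unary.Any using (here; there)
open import Data.List.Relation.Unary.All as All using (All; []; _∷_)
open import Data.List.Relation.Unary.All.Properties using (¬Any⇒All¬; All¬⇒¬Any; replicate⁺)
  renaming (map⁺ to All-map⁺)
open import Data.List.Relation.Unary.Unique.Propositional using (Unique; []; _∷_)
import Data.List.Relation.Unary.Unique.Propositional.Properties as Unique
open import Data.List.Relation.Binary.Permutation.Propositional
  using (_↭_; refl; prep; swap; trans; ↭-sym; ↭⇒↭ₛ)
open import Data.List.Relation.Binary.Permutation.Propositional.Properties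
  using (shift; ↭-length; All-resp-↭; filter-↭)
import Data.List.Relation.Binary.Permutation.Setoid.Properties as Permutationₛ
open import Data.List.Relation.Binary.BagAndSetEquality using (∼bag⇒↭)
open import Data.Nat using (ℕ; zero; suc; _+_; _*_; _∸_; _<_; _≤_; z≤n; s≤s; _<?_; _≟_)
open import Data.Nat.Properties
  using (<-trans; ≤-<-trans; <⇒≤; ≤-refl; ≤-pred; ≤∧≢⇒<; <⇒≱; <-asym; m≤n⇒m≤1+n; 1+n≰n; 1+n≢n;
         suc-injective; *-zeroʳ; *-identityʳ; +-identityʳ)
open import Data.Nat.Solver using (module +-*-Solver)
open import Data.List.Membership.DecPropositional _≟_ using (_∈?_)
open import Data.Product using (Σ-syntax; ∃₂; _×_; _,_; proj₁; proj₂)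
open import Function using (_∘_)
open import Function.Bundles using (mk⇔)
open import Relation.Nullary using (¬_; yes; no; ¬?)
open import Relation.Nullary.Decidable using (⌊_⌋; isYes≗does; dec-true; dec-false)
open import Relation.Binary.PropositionalEquality as ≡
  using (_≡_; _≢_; refl; sym; cong; cong₂; subst; module ≡-Reasoning)

⌊<?⌋-true : ∀ {m n} → m < n → ⌊ m <? n ⌋ ≡ true
⌊<?⌋-true {m} {n} m<n = ≡.trans (isYes≗does (m <? n)) (dec-true (m <? n) m<n)

⌊<?⌋-false : ∀ {m n} → ¬ m < n → ⌊ m <? n ⌋ ≡ false
⌊<?⌋-false {m} {n} m≮n = ≡.trans (isYes≗does (m <? n)) (dec-false (m <? n) m≮n)

∧-congʳ-if : ∀ {a b} c → (c ≡ true → a ≡ b) → a ∧ c ≡ b ∧ c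
∧-congʳ-if {a} {b} false _ = ≡.trans (∧-zeroʳ a) (sym (∧-zeroʳ b))
∧-congʳ-if true a≡b = cong (_∧ true) (a≡b refl)

∧-trueʳ : ∀ {a b} → a ∧ b ≡ true → b ≡ true
∧-trueʳ {true} b≡true = b≡true

-- Run-sorted words

descentBottoms : ℕ → List ℕ → List ℕ
descentBottoms y [] = []
descentBottoms y (z ∷ zs) with y <? z
... | yes _ = descentBottoms z zs
... | no  _ = z ∷ descentBottoms z zs

runs-∷ : ∀ y ys → Σ[ r ∈ List ℕ ] Σ[ rs ∈ List (List ℕ) ]
         runs (y ∷ ys) ≡ (y ∷ r) ∷ rs × heads rs ≡ descentBottoms y ys
runs-∷ y [] = [] , [] , refl , refl
runs-∷ y (z ∷ zs) with runs-∷ z zs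
... | r , rs , eq , hd rewrite eq with y <? z
...   | yes _ = z ∷ r , rs , refl , hd
...   | no  _ = [] , (z ∷ r) ∷ rs , refl , cong (z ∷_) hd

heads-runs : ∀ y ys → heads (runs (y ∷ ys)) ≡ y ∷ descentBottoms y ys
heads-runs y ys with runs-∷ y ys
... | r , rs , eq , hd rewrite eq | hd = refl

belowHead : ℕ → List ℕ → Bool
belowHead x [] = true
belowHead x (u ∷ _) = ⌊ x <? u ⌋

strictlyIncreasing-∷ : ∀ x us → strictlyIncreasing (x ∷ us) ≡ belowHead x us ∧ strictlyIncreasing us
strictlyIncreasing-∷ x [] = refl
strictlyIncreasing-∷ x (u ∷ us) = refl

belowHead-sorted : ∀ {x z} us → x < z → strictlyIncreasing (z ∷ us) ≡ true → belowHead x us ≡ true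
belowHead-sorted [] x<z _ = refl
belowHead-sorted {x} {z} (u ∷ us) x<z sorted with z <? u
... | yes z<u = ⌊<?⌋-true (<-trans x<z z<u)

-- Generalised from x = y so that the induction goes through.
allGreater-descentBottoms : ∀ {x} y ys → x ≤ y → strictlyIncreasing (descentBottoms y ys) ≡ true →
                            allGreater x ys ≡ belowHead x (descentBottoms y ys)
allGreater-descentBottoms y [] x≤y sorted = refl
allGreater-descentBottoms {x} y (z ∷ zs) x≤y sorted with y <? z
... | yes y<z rewrite ⌊<?⌋-true (≤-<-trans x≤y y<z) =
  allGreater-descentBottoms z zs (<⇒≤ (≤-<-trans x≤y y<z)) sorted
... | no _ with x <? z
...   | no  _   = refl
...   | yes x<z = ≡.trans (allGreater-descentBottoms z zs (<⇒≤ x<z) (∧-trueʳ sortedTail))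
                          (belowHead-sorted (descentBottoms z zs) x<z sorted)
  where sortedTail = ≡.trans (sym (strictlyIncreasing-∷ z (descentBottoms z zs))) sorted

-- headsMinimal w: every run minimum of w is a right-to-left minimum;
-- headsMinimalAfter p ys: the same for the entries of ys when ys follows the entry p.
headsMinimalAfter : ℕ → List ℕ → Bool
headsMinimalAfter p [] = true
headsMinimalAfter p (y ∷ ys) = (⌊ p <? y ⌋ ∨ allGreater y ys) ∧ headsMinimalAfter y ys

headsMinimal : List ℕ → Bool
headsMinimal [] = true
headsMinimal (x ∷ xs) = allGreater x xs ∧ headsMinimalAfter x xs

mutual
  strictlyIncreasing-descentBottoms : ∀ y ys →
    strictlyIncreasing (descentBottoms y ys) ≡ headsMinimalAfter y ys
  strictlyIncreasing-descentBottoms y [] = refl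
  strictlyIncreasing-descentBottoms y (z ∷ zs) with y <? z
  ... | yes _ = strictlyIncreasing-descentBottoms z zs
  ... | no  _ = strictlyIncreasing-∷-descentBottoms z zs

  strictlyIncreasing-∷-descentBottoms : ∀ y ys →
    strictlyIncreasing (y ∷ descentBottoms y ys) ≡ headsMinimal (y ∷ ys)
  strictlyIncreasing-∷-descentBottoms y ys = begin
    strictlyIncreasing (y ∷ descentBottoms y ys)
      ≡⟨ strictlyIncreasing-∷ y (descentBottoms y ys) ⟩
    belowHead y (descentBottoms y ys) ∧ strictlyIncreasing (descentBottoms y ys)
      ≡⟨ ∧-congʳ-if _ (λ sorted → sym (allGreater-descentBottoms y ys ≤-refl sorted)) ⟩
    allGreater y ys ∧ strictlyIncreasing (descentBottoms y ys)
      ≡⟨ cong (allGreater y ys ∧_) (strictlyIncreasing-descentBottoms y ys) ⟩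
    headsMinimal (y ∷ ys) ∎
    where open ≡-Reasoning

runSorted≡headsMinimal : ∀ w → runSorted w ≡ headsMinimal w
runSorted≡headsMinimal [] = refl
runSorted≡headsMinimal (y ∷ ys) = ≡.trans (cong strictlyIncreasing (heads-runs y ys))
                                          (strictlyIncreasing-∷-descentBottoms y ys)

-- Permutations of [n + 1] as insertions of n + 1

unique-↭ : ∀ {xs ys : List ℕ} → xs ↭ ys → Unique xs → Unique ys
unique-↭ p = Permutationₛ.Unique-resp-↭ (≡.setoid ℕ) (↭⇒↭ₛ p)

memb⇒∈ : ∀ x ys → memb x ys ≡ true → x ∈ ys
memb⇒∈ x (y ∷ ys) p with x ≟ y
... | yes x≡y = here x≡y
... | no  _   = there (memb⇒∈ x ys p)

∈⇒memb : ∀ {x ys} → x ∈ ys → memb x ys ≡ true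
∈⇒memb {x} {y ∷ ys} x∈ with x ≟ y | x∈
... | yes _   | _         = refl
... | no x≢y  | here x≡y  = ⊥-elim (x≢y x≡y)
... | no _    | there x∈′ = ∈⇒memb x∈′

distinct⇒unique : ∀ w → distinct w ≡ true → Unique w
distinct⇒unique [] _ = []
distinct⇒unique (x ∷ xs) p with memb x xs in eq
distinct⇒unique (x ∷ xs) p  | false = ¬Any⇒All¬ xs (not-¬ eq ∘ ∈⇒memb) ∷ distinct⇒unique xs p
distinct⇒unique (x ∷ xs) () | true

unique⇒distinct : ∀ w → Unique w → distinct w ≡ true
unique⇒distinct [] _ = refl
unique⇒distinct (x ∷ xs) (x∉xs ∷ u) with memb x xs in eq
... | true  = ⊥-elim (All¬⇒¬Any x∉xs (memb⇒∈ x xs eq))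
... | false = unique⇒distinct xs u

InRange : ℕ → ℕ → Set
InRange n x = 0 < x × x ≤ n

∈-range⁻ : ∀ n {x} → x ∈ range n → InRange n x
∈-range⁻ n x∈ with ∈-map⁻ suc x∈
... | i , i∈ , refl = s≤s z≤n , ∈-upTo⁻ i∈

∈-range⁺ : ∀ n {x} → InRange n x → x ∈ range n
∈-range⁺ n {suc i} (_ , i<n) = ∈-map⁺ suc (∈-upTo⁺ i<n)

range-unique : ∀ n → Unique (range n)
range-unique n = Unique.map⁺ suc-injective (Unique.upTo⁺ n)

concatMap-prepend : ∀ (W : List (List ℕ)) A →
  concatMap (λ a → map (a ∷_) W) A ≡ cartesianProductWith _∷_ A W
concatMap-prepend W [] = refl
concatMap-prepend W (a ∷ A) = cong (map (a ∷_) W ++_) (concatMap-prepend W A)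

words-suc : ∀ A k → words A (suc k) ≡ cartesianProductWith _∷_ A (words A k)
words-suc A k = concatMap-prepend (words A k) A

∈-words⁻ : ∀ A k {w} → w ∈ words A k → length w ≡ k × All (_∈ A) w
∈-words⁻ A zero (here refl) = refl , []
∈-words⁻ A (suc k) w∈ with ∈-cartesianProductWith⁻ _∷_ A (words A k) (subst (_ ∈_) (words-suc A k) w∈)
... | a , v , a∈ , v∈ , refl with ∈-words⁻ A k v∈
...   | len , v⊆A = cong suc len , a∈ ∷ v⊆A

∈-words⁺ : ∀ A {w} → All (_∈ A) w → w ∈ words A (length w)
∈-words⁺ A [] = here refl
∈-words⁺ A {x ∷ w} (x∈ ∷ w⊆A) =
  subst (_ ∈_) (sym (words-suc A (length w))) (∈-cartesianProductWith⁺ _∷_ x∈ (∈-words⁺ A w⊆A))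

words-unique : ∀ {A} → Unique A → ∀ k → Unique (words A k)
words-unique uA zero = [] ∷ []
words-unique {A} uA (suc k) rewrite words-suc A k =
  Unique.cartesianProductWith⁺ _∷_ ∷-injective uA (words-unique uA k)

IsPerm : ℕ → List ℕ → Set
IsPerm n w = length w ≡ n × All (InRange n) w × Unique w

∈-perms⁻ : ∀ n {w} → w ∈ perms n → IsPerm n w
∈-perms⁻ n w∈ with ∈-filter⁻ (λ w → distinct w Bool.≟ true) w∈
... | w∈words , d with ∈-words⁻ (range n) n w∈words
...   | len , w⊆ = len , All.map (∈-range⁻ n) w⊆ , distinct⇒unique _ d

∈-perms⁺ : ∀ n {w} → IsPerm n w → w ∈ perms n
∈-perms⁺ n (refl , bounded , u) =
  ∈-filter⁺ (λ w → distinct w Bool.≟ true) (∈-words⁺ (range n) (All.map (∈-range⁺ n) bounded))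
            (unique⇒distinct _ u)

perms-unique : ∀ n → Unique (perms n)
perms-unique n = Unique.filter⁺ (λ w → distinct w Bool.≟ true) (words-unique (range-unique n) n)

IsPerm-resp-↭ : ∀ {n xs ys} → xs ↭ ys → IsPerm n xs → IsPerm n ys
IsPerm-resp-↭ p (len , bounded , u) = ≡.trans (sym (↭-length p)) len , All-resp-↭ p bounded , unique-↭ p u

All-InRange-pred : ∀ {m xs} → suc m ∉ xs → All (InRange (suc m)) xs → All (InRange m) xs
All-InRange-pred m∉ bounded = All.tabulate λ x∈ →
  let (0<x , x≤1+m) = All.lookup bounded x∈ in 0<x , ≤-pred (≤∧≢⇒< x≤1+m (λ { refl → m∉ x∈ }))

IsPerm-∷⁻ : ∀ {m σ} → IsPerm (suc m) (suc m ∷ σ) → IsPerm m σ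
IsPerm-∷⁻ (len , _ ∷ bounded , u@(_ ∷ uσ)) =
  suc-injective len , All-InRange-pred (Unique.Unique[x∷xs]⇒x∉xs u) bounded , uσ

IsPerm-∷⁺ : ∀ {m σ} → IsPerm m σ → IsPerm (suc m) (suc m ∷ σ)
IsPerm-∷⁺ (len , bounded , u) =
  cong suc len ,
  (s≤s z≤n , ≤-refl) ∷ All.map (λ (0<x , x≤m) → 0<x , m≤n⇒m≤1+n x≤m) bounded ,
  All.map (λ { (_ , x≤m) refl → 1+n≰n x≤m }) bounded ∷ u

unique-bounded-length : ∀ m {xs} → Unique xs → All (InRange m) xs → length xs ≤ m
unique-bounded-length zero {[]} _ _ = z≤n
unique-bounded-length zero {x ∷ xs} _ ((0<x , x≤0) ∷ _) = ⊥-elim (<⇒≱ 0<x x≤0)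
unique-bounded-length (suc m) {xs} u bounded with suc m ∈? xs
... | no m∉ = m≤n⇒m≤1+n (unique-bounded-length m u (All-InRange-pred m∉ bounded))
... | yes m∈ with ∈-∃++ m∈
...   | pre , post , refl with unique-↭ (shift (suc m) pre post) u
...     | m∉ ∷ u′ = subst (_≤ suc m) (sym (↭-length (shift (suc m) pre post)))
                      (s≤s (unique-bounded-length m u′ (All-InRange-pred (All¬⇒¬Any m∉) bounded′)))
  where bounded′ = All.tail (All-resp-↭ (shift (suc m) pre post) bounded)

IsPerm-∋-max : ∀ {m w} → IsPerm (suc m) w → suc m ∈ w
IsPerm-∋-max {m} {w} (len , bounded , u) with suc m ∈? w
... | yes m∈ = m∈
... | no  m∉ = ⊥-elim (1+n≰n (subst (_≤ m) len (unique-bounded-length m u (All-InRange-pred m∉ bounded))))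

insertions : ℕ → List ℕ → List (List ℕ)
insertions a [] = [ a ] ∷ []
insertions a (x ∷ xs) = (a ∷ x ∷ xs) ∷ map (x ∷_) (insertions a xs)

∈-insertions⁻ : ∀ a σ {w} → w ∈ insertions a σ → ∃₂ λ pre post → σ ≡ pre ++ post × w ≡ pre ++ a ∷ post
∈-insertions⁻ a [] (here refl) = [] , [] , refl , refl
∈-insertions⁻ a (x ∷ σ) (here refl) = [] , x ∷ σ , refl , refl
∈-insertions⁻ a (x ∷ σ) (there w∈) with ∈-map⁻ (x ∷_) w∈
... | v , v∈ , refl with ∈-insertions⁻ a σ v∈
...   | pre , post , refl , refl = x ∷ pre , post , refl , refl

∈-insertions⁺ : ∀ a pre post → pre ++ a ∷ post ∈ insertions a (pre ++ post)
∈-insertions⁺ a [] [] = here refl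
∈-insertions⁺ a [] (x ∷ post) = here refl
∈-insertions⁺ a (x ∷ pre) post = there (∈-map⁺ (x ∷_) (∈-insertions⁺ a pre post))

insertions-unique : ∀ a σ → a ∉ σ → Unique (insertions a σ)
insertions-unique a [] _ = [] ∷ []
insertions-unique a (x ∷ σ) a∉ =
  All.tabulate front≢ ∷ Unique.map⁺ ∷-injectiveʳ (insertions-unique a σ (a∉ ∘ there))
  where
  front≢ : ∀ {v} → v ∈ map (x ∷_) (insertions a σ) → a ∷ x ∷ σ ≢ v
  front≢ v∈ eq with ∈-map⁻ (x ∷_) v∈
  ... | _ , _ , refl = a∉ (here (∷-injectiveˡ eq))

erase-insertions : ∀ a σ {w} → a ∉ σ → w ∈ insertions a σ → filter (λ x → ¬? (a ≟ x)) w ≡ σ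
erase-insertions a σ a∉ w∈ with ∈-insertions⁻ a σ w∈
... | pre , post , refl , refl = begin
  filter keep (pre ++ a ∷ post)
    ≡⟨ filter-++ keep pre (a ∷ post) ⟩
  filter keep pre ++ filter keep (a ∷ post)
    ≡⟨ cong₂ _++_ (filter-all keep (¬Any⇒All¬ pre (a∉ ∘ ∈-++⁺ˡ)))
                  (≡.trans (filter-reject keep (λ a≢a → a≢a refl))
                           (filter-all keep (¬Any⇒All¬ post (a∉ ∘ ∈-++⁺ʳ pre)))) ⟩
  pre ++ post ∎
  where
  open ≡-Reasoning
  keep = λ x → ¬? (a ≟ x)

concatMap-insertions-unique : ∀ a {L} → Unique L → All (a ∉_) L → Unique (concatMap (insertions a) L)
concatMap-insertions-unique a [] [] = []
concatMap-insertions-unique a {σ ∷ L} (σ∉L ∷ uL) (a∉σ ∷ a∉L) =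
  Unique.++⁺ (insertions-unique a σ a∉σ) (concatMap-insertions-unique a uL a∉L) disjoint
  where
  disjoint : ∀ {w} → ¬ (w ∈ insertions a σ × w ∈ concatMap (insertions a) L)
  disjoint (w∈σ , w∈L) with find (∈-concatMap⁻ (insertions a) {xs = L} w∈L)
  ... | τ , τ∈L , w∈τ = All.lookup σ∉L τ∈L
    (≡.trans (sym (erase-insertions a σ a∉σ w∈σ)) (erase-insertions a τ (All.lookup a∉L τ∈L) w∈τ))

perms-suc↭ : ∀ m → perms (suc m) ↭ concatMap (insertions (suc m)) (perms m)
perms-suc↭ m = ∼bag⇒↭ (unique∧set⇒bag (perms-unique (suc m))
  (concatMap-insertions-unique (suc m) (perms-unique m) (All.tabulate (λ σ∈ → max∉ (∈-perms⁻ m σ∈))))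
  (mk⇔ to from))
  where
  max∉ : ∀ {σ} → IsPerm m σ → suc m ∉ σ
  max∉ (_ , bounded , _) m∈ = 1+n≰n (proj₂ (All.lookup bounded m∈))

  to : ∀ {w} → w ∈ perms (suc m) → w ∈ concatMap (insertions (suc m)) (perms m)
  to w∈ with ∈-∃++ (IsPerm-∋-max (∈-perms⁻ (suc m) w∈))
  ... | pre , post , refl = ∈-concatMap⁺ (insertions (suc m)) (lose σ∈ (∈-insertions⁺ (suc m) pre post))
    where
    σ∈ = ∈-perms⁺ m (IsPerm-∷⁻ (IsPerm-resp-↭ (shift (suc m) pre post) (∈-perms⁻ (suc m) w∈)))

  from : ∀ {w} → w ∈ concatMap (insertions (suc m)) (perms m) → w ∈ perms (suc m)
  from w∈ with find (∈-concatMap⁻ (insertions (suc m)) {xs = perms m} w∈)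
  ... | σ , σ∈ , w∈σ with ∈-insertions⁻ (suc m) σ w∈σ
  ...   | pre , post , refl , refl =
    ∈-perms⁺ (suc m) (IsPerm-resp-↭ (↭-sym (shift (suc m) pre post)) (IsPerm-∷⁺ (∈-perms⁻ m σ∈)))

-- Right-to-left minima of the insertions

rlProfile : (List ℕ → Bool) → List (List ℕ) → List ℕ
rlProfile P [] = []
rlProfile P (w ∷ ws) = if P w then rlMinima w ∷ rlProfile P ws else rlProfile P ws

rlProfile-++ : ∀ P xs ys → rlProfile P (xs ++ ys) ≡ rlProfile P xs ++ rlProfile P ys
rlProfile-++ P [] ys = refl
rlProfile-++ P (w ∷ xs) ys with P w
... | true  = cong (rlMinima w ∷_) (rlProfile-++ P xs ys)
... | false = rlProfile-++ P xs ys

rlProfile-↭ : ∀ P {xs ys} → xs ↭ ys → rlProfile P xs ↭ rlProfile P ys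
rlProfile-↭ P refl = refl
rlProfile-↭ P (prep w p) with P w
... | true  = prep _ (rlProfile-↭ P p)
... | false = rlProfile-↭ P p
rlProfile-↭ P (swap v w p) with P v | P w
... | true  | true  = swap _ _ (rlProfile-↭ P p)
... | true  | false = prep _ (rlProfile-↭ P p)
... | false | true  = prep _ (rlProfile-↭ P p)
... | false | false = rlProfile-↭ P p
rlProfile-↭ P (trans p q) = trans (rlProfile-↭ P p) (rlProfile-↭ P q)

rlProfile-none : ∀ {P ws} → All (λ w → P w ≡ false) ws → rlProfile P ws ≡ []
rlProfile-none [] = refl
rlProfile-none (P≡false ∷ rest) rewrite P≡false = rlProfile-none rest

rlProfile-map : ∀ {P Q} (g : List ℕ → List ℕ) (f : ℕ → ℕ) {ws} →
  All (λ w → P (g w) ≡ Q w × rlMinima (g w) ≡ f (rlMinima w)) ws →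
  rlProfile P (map g ws) ≡ map f (rlProfile Q ws)
rlProfile-map g f [] = refl
rlProfile-map {P} {Q} g f {w ∷ ws} ((P≡Q , rl≡) ∷ rest) rewrite P≡Q | rl≡ with Q w
... | true  = cong (f (rlMinima w) ∷_) (rlProfile-map g f rest)
... | false = rlProfile-map g f rest

allGreater-insertions : ∀ {y a} → y < a → ∀ τ → All (λ w → allGreater y w ≡ allGreater y τ) (insertions a τ)
allGreater-insertions y<a [] = cong (_∧ true) (⌊<?⌋-true y<a) ∷ []
allGreater-insertions {y} y<a (x ∷ xs) =
  cong (_∧ allGreater y (x ∷ xs)) (⌊<?⌋-true y<a) ∷
  All-map⁺ (All.map (cong (⌊ y <? x ⌋ ∧_)) (allGreater-insertions y<a xs))

module _ {a y : ℕ} (y<a : y < a) (τ : List ℕ) (P : List ℕ → Bool) where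

  rlProfile-∷-insertions-min : ∀ b → (∀ w → P (y ∷ w) ≡ (b ∨ allGreater y w) ∧ headsMinimalAfter y w) →
    allGreater y τ ≡ true →
    rlProfile P (map (y ∷_) (insertions a τ)) ≡ map suc (rlProfile (headsMinimalAfter y) (insertions a τ))
  rlProfile-∷-insertions-min b P-∷ g = rlProfile-map (y ∷_) suc (All.map step (allGreater-insertions y<a τ))
    where
    step : ∀ {w} → allGreater y w ≡ allGreater y τ →
           P (y ∷ w) ≡ headsMinimalAfter y w × rlMinima (y ∷ w) ≡ suc (rlMinima w)
    step {w} eq rewrite P-∷ w | ≡.trans eq g | ∨-zeroʳ b = refl , refl

  rlProfile-∷-insertions-nonmin : ∀ b → (∀ w → P (y ∷ w) ≡ (b ∨ allGreater y w) ∧ headsMinimalAfter y w) →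
    allGreater y τ ≡ false →
    rlProfile P (map (y ∷_) (insertions a τ)) ≡ (if b then rlProfile (headsMinimalAfter y) (insertions a τ) else [])
  rlProfile-∷-insertions-nonmin true P-∷ g =
    ≡.trans (rlProfile-map (y ∷_) (λ r → r) (All.map step (allGreater-insertions y<a τ))) (map-id _)
    where
    step : ∀ {w} → allGreater y w ≡ allGreater y τ →
           P (y ∷ w) ≡ headsMinimalAfter y w × rlMinima (y ∷ w) ≡ rlMinima w
    step {w} eq rewrite P-∷ w | ≡.trans eq g = refl , refl
  rlProfile-∷-insertions-nonmin false P-∷ g = rlProfile-none (All-map⁺ (All.map step (allGreater-insertions y<a τ)))
    where
    step : ∀ {w} → allGreater y w ≡ allGreater y τ → P (y ∷ w) ≡ false
    step {w} eq rewrite P-∷ w | ≡.trans eq g = refl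

offspring : ℕ → List ℕ
offspring r = replicate (r ∸ 1) r ++ [ suc r ]

map-suc-offspring : ∀ r → map suc (replicate r r ++ [ suc r ]) ≡ offspring (suc r)
map-suc-offspring r =
  ≡.trans (map-++ suc (replicate r r) [ suc r ]) (cong (_++ [ suc (suc r) ]) (map-replicate suc r r))

-- Since p < a, a may also go in front of τ: every right-to-left minimum of τ may be preceded by a.
rlProfile-insertions-after : ∀ {a p} τ → p < a → All (_< a) τ →
  rlProfile (headsMinimalAfter p) (insertions a τ)
    ≡ (if headsMinimalAfter p τ then replicate (rlMinima τ) (rlMinima τ) ++ [ suc (rlMinima τ) ] else [])
rlProfile-insertions-after {a} {p} [] p<a [] rewrite ⌊<?⌋-true p<a = refl
rlProfile-insertions-after {a} {p} (y ∷ τ) p<a (y<a ∷ τ<a)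
  rewrite ⌊<?⌋-true p<a | ⌊<?⌋-false (<-asym y<a) with allGreater y τ in g
... | true  rewrite rlProfile-∷-insertions-min y<a τ (headsMinimalAfter p) ⌊ p <? y ⌋ (λ _ → refl) g
                  | rlProfile-insertions-after τ y<a τ<a | ∨-zeroʳ ⌊ p <? y ⌋ with headsMinimalAfter y τ
...   | true  = cong (suc (rlMinima τ) ∷_) (map-suc-offspring (rlMinima τ))
...   | false = refl
rlProfile-insertions-after {a} {p} (y ∷ τ) p<a (y<a ∷ τ<a)
    | false rewrite rlProfile-∷-insertions-nonmin y<a τ (headsMinimalAfter p) ⌊ p <? y ⌋ (λ _ → refl) g
                  | rlProfile-insertions-after τ y<a τ<a with ⌊ p <? y ⌋
...   | true  = refl
...   | false = refl

rlProfile-insertions : ∀ {a} σ → All (_< a) σ →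
  rlProfile headsMinimal (insertions a σ) ≡ (if headsMinimal σ then offspring (rlMinima σ) else [])
rlProfile-insertions [] [] = refl
rlProfile-insertions {a} (x ∷ σ) (x<a ∷ σ<a) rewrite ⌊<?⌋-false (<-asym x<a) with allGreater x σ in g
... | true  rewrite rlProfile-∷-insertions-min x<a σ headsMinimal false (λ _ → refl) g
                  | rlProfile-insertions-after σ x<a σ<a with headsMinimalAfter x σ
...   | true  = map-suc-offspring (rlMinima σ)
...   | false = refl
rlProfile-insertions {a} (x ∷ σ) (x<a ∷ σ<a)
    | false = rlProfile-∷-insertions-nonmin x<a σ headsMinimal false (λ _ → refl) g

rlProfile-concatMap-insertions : ∀ a L → All (All (_< a)) L →
  rlProfile headsMinimal (concatMap (insertions a) L) ≡ concatMap offspring (rlProfile headsMinimal L)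
rlProfile-concatMap-insertions a [] [] = refl
rlProfile-concatMap-insertions a (σ ∷ L) (σ<a ∷ L<a)
  rewrite rlProfile-++ headsMinimal (insertions a σ) (concatMap (insertions a) L)
        | rlProfile-insertions σ σ<a | rlProfile-concatMap-insertions a L L<a with headsMinimal σ
... | true  = refl
... | false = refl

-- Counting

multiplicity : ℕ → List ℕ → ℕ
multiplicity r = length ∘ filter (_≟ r)

multiplicity-++ : ∀ r xs ys → multiplicity r (xs ++ ys) ≡ multiplicity r xs + multiplicity r ys
multiplicity-++ r xs ys = ≡.trans (cong length (filter-++ (_≟ r) xs ys)) (length-++ (filter (_≟ r) xs))

multiplicity-↭ : ∀ r {xs ys} → xs ↭ ys → multiplicity r xs ≡ multiplicity r ys
multiplicity-↭ r p = ↭-length (filter-↭ (_≟ r) p)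

multiplicity-replicate-≡ : ∀ r k → multiplicity r (replicate k r) ≡ k
multiplicity-replicate-≡ r k =
  ≡.trans (cong length (filter-all (_≟ r) (replicate⁺ k refl))) (length-replicate k)

multiplicity-replicate-≢ : ∀ {s} r k → s ≢ r → multiplicity r (replicate k s) ≡ 0
multiplicity-replicate-≢ r k s≢r = cong length (filter-none (_≟ r) (replicate⁺ k s≢r))

multiplicity-offspring : ∀ r R →
  multiplicity (suc r) (offspring R) ≡ multiplicity r [ R ] + r * multiplicity (suc r) [ R ]
multiplicity-offspring r R
  rewrite multiplicity-++ (suc r) (replicate (R ∸ 1) R) [ suc R ] with R ≟ r
... | yes refl
  rewrite multiplicity-replicate-≢ (suc r) (r ∸ 1) (1+n≢n ∘ sym) | multiplicity-replicate-≡ (suc r) 1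
        | multiplicity-replicate-≡ r 1 | multiplicity-replicate-≢ (suc r) 1 (1+n≢n ∘ sym) | *-zeroʳ r = refl
... | no R≢r with R ≟ suc r
...   | yes refl
  rewrite multiplicity-replicate-≡ (suc r) r | multiplicity-replicate-≢ (suc r) 1 1+n≢n
        | multiplicity-replicate-≢ r 1 1+n≢n | multiplicity-replicate-≡ (suc r) 1 | *-identityʳ r = +-identityʳ r
...   | no R≢1+r
  rewrite multiplicity-replicate-≢ (suc r) (R ∸ 1) R≢1+r | multiplicity-replicate-≢ (suc r) 1 (R≢r ∘ suc-injective)
        | multiplicity-replicate-≢ r 1 R≢r | multiplicity-replicate-≢ (suc r) 1 R≢1+r | *-zeroʳ r = refl

multiplicity-concatMap-offspring : ∀ r Rs →
  multiplicity (suc r) (concatMap offspring Rs) ≡ multiplicity r Rs + r * multiplicity (suc r) Rs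
multiplicity-concatMap-offspring r [] = sym (*-zeroʳ r)
multiplicity-concatMap-offspring r (R ∷ Rs) = begin
  multiplicity (suc r) (offspring R ++ concatMap offspring Rs)
    ≡⟨ multiplicity-++ (suc r) (offspring R) (concatMap offspring Rs) ⟩
  multiplicity (suc r) (offspring R) + multiplicity (suc r) (concatMap offspring Rs)
    ≡⟨ cong₂ _+_ (multiplicity-offspring r R) (multiplicity-concatMap-offspring r Rs) ⟩
  (a + r * b) + (c + r * d)
    ≡⟨ regroup a b c d r ⟩
  (a + c) + r * (b + d)
    ≡⟨ sym (cong₂ (λ x y → x + r * y) (multiplicity-++ r [ R ] Rs) (multiplicity-++ (suc r) [ R ] Rs)) ⟩
  multiplicity r (R ∷ Rs) + r * multiplicity (suc r) (R ∷ Rs) ∎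
  where
  open ≡-Reasoning
  open +-*-Solver
  a = multiplicity r [ R ]
  b = multiplicity (suc r) [ R ]
  c = multiplicity r Rs
  d = multiplicity (suc r) Rs
  regroup : ∀ a b c d r → (a + r * b) + (c + r * d) ≡ (a + c) + r * (b + d)
  regroup = solve 5 (λ a b c d r → (a :+ r :* b) :+ (c :+ r :* d) := (a :+ c) :+ r :* (b :+ d)) refl

h≡multiplicity : ∀ n r → h n r ≡ multiplicity r (rlProfile headsMinimal (perms n))
h≡multiplicity n r = go (perms n)
  where
  go : ∀ ws → length (filter (λ w → (runSorted w ∧ ⌊ rlMinima w ≟ r ⌋) Bool.≟ true) ws)
              ≡ multiplicity r (rlProfile headsMinimal ws)
  go [] = refl
  go (w ∷ ws) rewrite runSorted≡headsMinimal w with headsMinimal w | rlMinima w ≟ r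
  ... | true  | yes R≡r = ≡.trans (cong suc (go ws)) (sym (cong length (filter-accept (_≟ r) R≡r)))
  ... | true  | no  R≢r = ≡.trans (go ws) (sym (cong length (filter-reject (_≟ r) R≢r)))
  ... | false | _       = go ws

h-recurrence : ∀ m r → h (suc m) (suc r) ≡ h m r + r * h m (suc r)
h-recurrence m r = begin
  h (suc m) (suc r)
    ≡⟨ h≡multiplicity (suc m) (suc r) ⟩
  multiplicity (suc r) (rlProfile headsMinimal (perms (suc m)))
    ≡⟨ multiplicity-↭ (suc r) (rlProfile-↭ headsMinimal (perms-suc↭ m)) ⟩
  multiplicity (suc r) (rlProfile headsMinimal (concatMap (insertions (suc m)) (perms m)))
    ≡⟨ cong (multiplicity (suc r)) (rlProfile-concatMap-insertions (suc m) (perms m) perms-bounded) ⟩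
  multiplicity (suc r) (concatMap offspring Rs)
    ≡⟨ multiplicity-concatMap-offspring r Rs ⟩
  multiplicity r Rs + r * multiplicity (suc r) Rs
    ≡⟨ sym (cong₂ (λ x y → x + r * y) (h≡multiplicity m r) (h≡multiplicity m (suc r))) ⟩
  h m r + r * h m (suc r) ∎
  where
  open ≡-Reasoning
  Rs = rlProfile headsMinimal (perms m)
  perms-bounded : All (All (_< suc m)) (perms m)
  perms-bounded = All.tabulate λ σ∈ → All.map (s≤s ∘ proj₂) (proj₁ (proj₂ (∈-perms⁻ m σ∈)))

proposition27 : (h 1 1 ≡ 1)
    × (∀ (n r : ℕ) → 2 ≤ r → r ≤ n → h n r ≡ h (n ∸ 1) (r ∸ 1) + (r ∸ 1) * h (n ∸ 1) r)
proposition27 = refl , recurrence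
  where
  recurrence : ∀ (n r : ℕ) → 2 ≤ r → r ≤ n → h n r ≡ h (n ∸ 1) (r ∸ 1) + (r ∸ 1) * h (n ∸ 1) r
  recurrence (suc m) (suc r) _ _ = h-recurrence m r
  recurrence zero    (suc r) _ ()
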